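{- The axiomatization consisting of A1-4, IF1 and IF2 is sound and ground-complete for BCCSP($A$) modulo $\precsim_{\rm IF}$.
   Context: $A$ is a nonempty countable set of actions. BCCSP($A$) terms: $t::=0\mid x\mid at\mid t+t$ ($x$ a variable, $a\in A$); closed terms contain no variables. Transitions: $at\xrightarrow{a}t$; if $t\xrightarrow{a}t'$ then $t+u\xrightarrow{a}t'$ and $u+t\xrightarrow{a}t'$. $a_1\cdots a_k$ is a trace of $s$ if $s\xrightarrow{a_1}\cdots\xrightarrow{a_k}s'$ for some $s'$; $\mathcal{T}(s)$ is the set of traces. $(a_1\cdots a_k,B)$ with $B\subseteq A^*$ is an impossible future of $s$ if $s\xrightarrow{a_1}\cdots\xrightarrow{a_k}s'$ with $\mathcal{T}(s')\cap B=\emptyset$. $s_1\precsim_{\rm IF}s_2$ iff every impossible future of $s_1$ is one of $s_2$; on open terms via all closed substitutions. Inequational logic (reflexivity, transitivity, substitution instances, closure under contexts; an equation abbreviates two inequations). Sound: derivable inequations hold modulo $\precsim_{\rm IF}$; ground-complete: closed $p\precsim_{\rm IF}q$ implies $p\preccurlyeq q$ derivable. Axioms (action $a$ ranges over $A$): A1: $x+y\approx y+x$; A2: $(x+y)+z\approx x+(y+z)$; A3: $x+x\approx x$; A4: $x+0\approx x$; IF1: $a(x+y)\preccurlyeq ax+ay$; IF2: $ax+a(y+z)\approx a(x+y)+ax+a(y+z)$. -}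

module Defs where

open import Data.Empty using (⊥; ⊥-elim)
open import Data.Nat using (ℕ)
open import Data.List using (List; []; _∷_)
open import Data.Product using (Σ; ∃; _×_; _,_)
open import Relation.Nullary using (¬_)

data Term (A : Set) (V : Set) : Set where
  𝟎   : Term A V
  var : V → Term A V
  _·_ : A → Term A V → Term A V
  _⊕_ : Term A V → Term A V → Term A V

infixr 7 _·_
infixl 6 _⊕_

Closed : Set → Set
Closed A = Term A ⊥

Open : Set → Set
Open A = Term A ℕ

subst : {A V W : Set} → (V → Term A W) → Term A V → Term A W
subst σ 𝟎       = 𝟎
subst σ (var x) = σ x
subst σ (a · t) = a · subst σ t
subst σ (t ⊕ u) = subst σ t ⊕ subst σ u

embed : {A : Set} → Closed A → Open A
embed = subst (λ ())

data _—⟨_⟩→_ {A V : Set} : Term A V → A → Term A V → Set where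
  act  : ∀ {a t} → (a · t) —⟨ a ⟩→ t
  sumˡ : ∀ {t u a t'} → t —⟨ a ⟩→ t' → (t ⊕ u) —⟨ a ⟩→ t'
  sumʳ : ∀ {t u a t'} → t —⟨ a ⟩→ t' → (u ⊕ t) —⟨ a ⟩→ t'

data _—⟨_⟩→*_ {A V : Set} : Term A V → List A → Term A V → Set where
  done : ∀ {s} → s —⟨ [] ⟩→* s
  step : ∀ {s a s' w s''} → s —⟨ a ⟩→ s' → s' —⟨ w ⟩→* s'' → s —⟨ a ∷ w ⟩→* s''

Trace : {A : Set} → Closed A → List A → Set
Trace s w = ∃ λ s' → s —⟨ w ⟩→* s'

ImpossibleFuture : {A : Set} → Closed A → List A → (List A → Set) → Set
ImpossibleFuture s w B = ∃ λ s' → (s —⟨ w ⟩→* s') × (∀ v → Trace s' v → ¬ B v)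

_≾IF_ : {A : Set} → Closed A → Closed A → Set₁
_≾IF_ {A} s₁ s₂ = ∀ (w : List A) (B : List A → Set) →
  ImpossibleFuture s₁ w B → ImpossibleFuture s₂ w B

_≾IFᵒ_ : {A : Set} → Open A → Open A → Set₁
_≾IFᵒ_ {A} t u = ∀ (σ : ℕ → Closed A) → subst σ t ≾IF subst σ u

x y z : {A : Set} → Open A
x = var 0
y = var 1
z = var 2

-- the axioms A1-A4, IF1, IF2 as inequations (each equation gives two)
data Axiom {A : Set} : Open A → Open A → Set where
  A1    : Axiom (x ⊕ y) (y ⊕ x)
  A1'   : Axiom (y ⊕ x) (x ⊕ y)
  A2    : Axiom ((x ⊕ y) ⊕ z) (x ⊕ (y ⊕ z))
  A2'   : Axiom (x ⊕ (y ⊕ z)) ((x ⊕ y) ⊕ z)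
  A3    : Axiom (x ⊕ x) x
  A3'   : Axiom x (x ⊕ x)
  A4    : Axiom (x ⊕ 𝟎) x
  A4'   : Axiom x (x ⊕ 𝟎)
  IF1   : ∀ (a : A) → Axiom (a · (x ⊕ y)) (a · x ⊕ a · y)
  IF2   : ∀ (a : A) → Axiom (a · x ⊕ a · (y ⊕ z)) (a · (x ⊕ y) ⊕ a · x ⊕ a · (y ⊕ z))
  IF2'  : ∀ (a : A) → Axiom (a · (x ⊕ y) ⊕ a · x ⊕ a · (y ⊕ z)) (a · x ⊕ a · (y ⊕ z))

infix 4 _⊢_≼_

data _⊢_≼_ {A : Set} (Ax : Open A → Open A → Set) : Open A → Open A → Set where
  ax    : ∀ {t u} → Ax t u → Ax ⊢ t ≼ u
  refl  : ∀ {t} → Ax ⊢ t ≼ t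
  trans : ∀ {t u v} → Ax ⊢ t ≼ u → Ax ⊢ u ≼ v → Ax ⊢ t ≼ v
  inst  : ∀ {t u} (σ : ℕ → Open A) → Ax ⊢ t ≼ u → Ax ⊢ subst σ t ≼ subst σ u
  ctx·  : ∀ {t u} (a : A) → Ax ⊢ t ≼ u → Ax ⊢ a · t ≼ a · u
  ctx⊕  : ∀ {t t' u u'} → Ax ⊢ t ≼ t' → Ax ⊢ u ≼ u' → Ax ⊢ t ⊕ u ≼ t' ⊕ u'

module Submission where

-- With decidable equality on actions, traces of closed
-- terms are decidable, and p ≾IF q holds iff (i) every trace of q is one of p
-- and (ii) every run p —w→* p' with w nonempty is matched by a run
-- q —w→* q' whose traces are among those of p'  (written p ≾ᶠ q).
--
-- Soundness.  Each axiom instance is checked against this characterisation,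
-- and ≾IF is a precongruence closed under substitution.
--
-- For closed p ≾IF q we derive  p ≼ p + q ≼ q + p ≼ q :
--  * pumping: if every trace of q is one of p then p ≼ p + q  (induction on q,
--    using IF1 and the fact that p absorbs a·(sum of its a-derivatives));
--  * absorption: if p ≾ᶠ q then q + p ≼ q  (induction on p; a summand a·r is
--    absorbed through IF2, by a mutual induction on r).

open import Defs
open import Data.Nat as ℕ using (ℕ; zero; suc)
open import Data.Empty using (⊥-elim)
open import Data.List using ([]; _∷_)
open import Data.Product using (_×_; _,_; ∃; proj₁; proj₂)
open import Data.Sum using (_⊎_; inj₁; inj₂)
open import Function using (_∘_; id)
open import Function.Bundles using (_↣_)
open import Relation.Nullary using (¬_; Dec; yes; no)
open import Relation.Nullary.Decidable using (via-injection; map′; _×-dec_; _⊎-dec_; decidable-stable)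
open import Relation.Binary.Definitions using (DecidableEquality)
open import Relation.Binary.Bundles using (Preorder)
open import Relation.Binary.Structures using (IsPreorder)
open import Relation.Binary.PropositionalEquality as ≡ using (_≡_)
import Relation.Binary.Reasoning.Preorder as PreorderReasoning

module AxiomaticLaws (A : Set) where

  infix 4 _⊑_ _≈_ _absorbs_

  _⊑_ : Open A → Open A → Set
  t ⊑ u = Axiom ⊢ t ≼ u

  _≈_ : Open A → Open A → Set
  t ≈ u = (t ⊑ u) × (u ⊑ t)

  ⊑-preorder : Preorder _ _ _
  ⊑-preorder = record
    { Carrier    = Open A
    ; _≈_        = _≡_
    ; _≲_        = _⊑_
    ; isPreorder = record
      { isEquivalence = ≡.isEquivalence
      ; reflexive     = λ { ≡.refl → refl }
      ; trans         = trans
      }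
    }

  module ⊑-Reasoning = PreorderReasoning ⊑-preorder

  xyz↦ : Open A → Open A → Open A → ℕ → Open A
  xyz↦ t u v zero          = t
  xyz↦ t u v (suc zero)    = u
  xyz↦ t u v (suc (suc _)) = v

  ⊕-comm : ∀ t u → t ⊕ u ⊑ u ⊕ t
  ⊕-comm t u = inst (xyz↦ t u 𝟎) (ax A1)

  ⊕-assocˡ : ∀ t u v → (t ⊕ u) ⊕ v ⊑ t ⊕ (u ⊕ v)
  ⊕-assocˡ t u v = inst (xyz↦ t u v) (ax A2)

  ⊕-assocʳ : ∀ t u v → t ⊕ (u ⊕ v) ⊑ (t ⊕ u) ⊕ v
  ⊕-assocʳ t u v = inst (xyz↦ t u v) (ax A2')

  ⊕-idem : ∀ t → t ⊕ t ≈ t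
  ⊕-idem t = inst (xyz↦ t 𝟎 𝟎) (ax A3) , inst (xyz↦ t 𝟎 𝟎) (ax A3')

  ⊕-identity : ∀ t → t ⊕ 𝟎 ≈ t
  ⊕-identity t = inst (xyz↦ t 𝟎 𝟎) (ax A4) , inst (xyz↦ t 𝟎 𝟎) (ax A4')

  ·-split : ∀ a t u → a · (t ⊕ u) ⊑ a · t ⊕ a · u
  ·-split a t u = inst (xyz↦ t u 𝟎) (ax (IF1 a))

  ·-saturate : ∀ a t u v → a · t ⊕ a · (u ⊕ v) ≈ a · (t ⊕ u) ⊕ a · t ⊕ a · (u ⊕ v)
  ·-saturate a t u v = inst (xyz↦ t u v) (ax (IF2 a)) , inst (xyz↦ t u v) (ax (IF2' a))

  ·-cong : ∀ {t u} a → t ≈ u → a · t ≈ a · u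
  ·-cong a (t⊑u , u⊑t) = ctx· a t⊑u , ctx· a u⊑t

  ⊕-congˡ : ∀ {t t' u} → t ⊑ t' → t ⊕ u ⊑ t' ⊕ u
  ⊕-congˡ d = ctx⊕ d refl

  ⊕-congʳ : ∀ {t u u'} → u ⊑ u' → t ⊕ u ⊑ t ⊕ u'
  ⊕-congʳ d = ctx⊕ refl d

  ⊕-swapʳ : ∀ t u v → (t ⊕ u) ⊕ v ⊑ (t ⊕ v) ⊕ u
  ⊕-swapʳ t u v = trans (⊕-assocˡ t u v) (trans (⊕-congʳ (⊕-comm u v)) (⊕-assocʳ t v u))

  ⊕-distrib : ∀ t u v → (t ⊕ u) ⊕ v ⊑ (t ⊕ v) ⊕ (u ⊕ v)
  ⊕-distrib t u v = begin
    (t ⊕ u) ⊕ v         ≲⟨ ⊕-congʳ (proj₂ (⊕-idem v)) ⟩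
    (t ⊕ u) ⊕ (v ⊕ v)   ≲⟨ ⊕-assocˡ t u (v ⊕ v) ⟩
    t ⊕ (u ⊕ (v ⊕ v))   ≲⟨ ⊕-congʳ (⊕-assocʳ u v v) ⟩
    t ⊕ ((u ⊕ v) ⊕ v)   ≲⟨ ⊕-congʳ (⊕-comm (u ⊕ v) v) ⟩
    t ⊕ (v ⊕ (u ⊕ v))   ≲⟨ ⊕-assocʳ t v (u ⊕ v) ⟩
    (t ⊕ v) ⊕ (u ⊕ v)   ∎
    where open ⊑-Reasoning

  ⊕-nullʳ : ∀ {u} t → u ≈ 𝟎 → t ⊕ u ≈ t
  ⊕-nullʳ t (u⊑𝟎 , 𝟎⊑u) = trans (⊕-congʳ u⊑𝟎) (proj₁ (⊕-identity t))
                         , trans (proj₂ (⊕-identity t)) (⊕-congʳ 𝟎⊑u)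

  ⊕-nullˡ : ∀ {t} u → t ≈ 𝟎 → t ⊕ u ≈ u
  ⊕-nullˡ {t} u t≈𝟎 = trans (⊕-comm t u) (proj₁ (⊕-nullʳ u t≈𝟎))
                     , trans (proj₂ (⊕-nullʳ u t≈𝟎)) (⊕-comm u t)

  _absorbs_ : Open A → Open A → Set
  t absorbs c = t ⊕ c ≈ t

  absorbs-self : ∀ t → t absorbs t
  absorbs-self = ⊕-idem

  absorbs-⊕ˡ : ∀ {t c} u → t absorbs c → (t ⊕ u) absorbs c
  absorbs-⊕ˡ {t} {c} u (tc⊑t , t⊑tc) = trans (⊕-swapʳ t u c) (⊕-congˡ tc⊑t)
                                     , trans (⊕-congˡ t⊑tc) (⊕-swapʳ t c u)

  absorbs-⊕ʳ : ∀ {u c} t → u absorbs c → (t ⊕ u) absorbs c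
  absorbs-⊕ʳ {u} {c} t (uc⊑u , u⊑uc) = trans (⊕-assocˡ t u c) (⊕-congʳ uc⊑u)
                                     , trans (⊕-congʳ u⊑uc) (⊕-assocʳ t u c)

  absorbs-⊕ : ∀ {t c d} → t absorbs c → t absorbs d → t absorbs (c ⊕ d)
  absorbs-⊕ {t} {c} {d} (tc⊑t , t⊑tc) (td⊑t , t⊑td) =
      trans (⊕-assocʳ t c d) (trans (⊕-congˡ tc⊑t) td⊑t)
    , trans t⊑tc (trans (⊕-congˡ t⊑td) (trans (⊕-assocˡ t d c) (⊕-congʳ (⊕-comm d c))))

  absorbs-trans : ∀ {t c d} → t absorbs c → c absorbs d → t absorbs d
  absorbs-trans {t} {c} {d} (tc⊑t , t⊑tc) (cd⊑c , c⊑cd) =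
      trans (⊕-congˡ t⊑tc) (trans (⊕-assocˡ t c d) (trans (⊕-congʳ cd⊑c) tc⊑t))
    , trans t⊑tc (trans (⊕-congʳ c⊑cd) (trans (⊕-assocʳ t c d) (⊕-congˡ tc⊑t)))

  absorbs-resp : ∀ {t c c'} → t absorbs c → c' ≈ c → t absorbs c'
  absorbs-resp (tc⊑t , t⊑tc) (c'⊑c , c⊑c') = trans (⊕-congʳ c'⊑c) tc⊑t , trans t⊑tc (⊕-congʳ c⊑c')

  -- IF2 with z = 𝟎:  a·t + a·u  absorbs  a·(t + u)
  ·-absorbs : ∀ (a : A) (t u : Open A) → (a · t ⊕ a · u) absorbs a · (t ⊕ u)
  ·-absorbs a t u =
      trans (⊕-comm _ _) (trans (⊕-assocʳ _ _ _) (trans (⊕-congʳ u⊑u𝟎)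
        (trans (proj₂ saturated) (⊕-congʳ u𝟎⊑u))))
    , trans (⊕-congʳ u⊑u𝟎) (trans (proj₁ saturated) (trans (⊕-congʳ u𝟎⊑u)
        (trans (⊕-assocˡ _ _ _) (⊕-comm _ _))))
    where
      saturated : a · t ⊕ a · (u ⊕ 𝟎) ≈ a · (t ⊕ u) ⊕ a · t ⊕ a · (u ⊕ 𝟎)
      saturated = ·-saturate a t u 𝟎
      u𝟎⊑u : a · (u ⊕ 𝟎) ⊑ a · u
      u𝟎⊑u = ctx· a (proj₁ (⊕-identity u))
      u⊑u𝟎 : a · u ⊑ a · (u ⊕ 𝟎)
      u⊑u𝟎 = ctx· a (proj₂ (⊕-identity u))

module Traces (A : Set) where

  infix 4 _⊆T_ _⊆→_

  Enabled : A → Closed A → Set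
  Enabled a p = ∃ λ p' → p —⟨ a ⟩→ p'

  _⊆T_ : Closed A → Closed A → Set
  p ⊆T q = ∀ {v} → Trace p v → Trace q v

  _⊆→_ : Closed A → Closed A → Set
  p ⊆→ q = ∀ {a s} → p —⟨ a ⟩→ s → q —⟨ a ⟩→ s

  ⊆→-path : ∀ {p q a w p'} → p ⊆→ q → p —⟨ a ∷ w ⟩→* p' → q —⟨ a ∷ w ⟩→* p'
  ⊆→-path p→q (step t r) = step (p→q t) r

  steps⇒traces : ∀ {p q} → p ⊆→ q → p ⊆T q
  steps⇒traces p→q (_ , done)     = _ , done
  steps⇒traces p→q (s , step t r) = s , step (p→q t) r

  trace-⊕ˡ : ∀ {p q : Closed A} → p ⊆T p ⊕ q
  trace-⊕ˡ = steps⇒traces sumˡ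

  trace-⊕ʳ : ∀ {p q : Closed A} → q ⊆T p ⊕ q
  trace-⊕ʳ = steps⇒traces sumʳ

  trace-⊕⁻¹ : ∀ {p q : Closed A} {v} → Trace (p ⊕ q) v → Trace p v ⊎ Trace q v
  trace-⊕⁻¹ (_ , done)            = inj₁ (_ , done)
  trace-⊕⁻¹ (s , step (sumˡ t) r) = inj₁ (s , step t r)
  trace-⊕⁻¹ (s , step (sumʳ t) r) = inj₂ (s , step t r)

  trace-· : ∀ {a} {p : Closed A} {v} → Trace p v → Trace (a · p) (a ∷ v)
  trace-· (s , r) = s , step act r

  enabled-of : ∀ {a p w} → Trace p (a ∷ w) → Enabled a p
  enabled-of (_ , step t _) = _ , t

module Derivatives (A : Set) (_≟_ : DecidableEquality A) where

  open Traces A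

  deriv : A → Closed A → Closed A
  deriv a 𝟎 = 𝟎
  deriv a (var ())
  deriv a (b · p) with a ≟ b
  ... | yes _ = p
  ... | no _  = 𝟎
  deriv a (p ⊕ q) = deriv a p ⊕ deriv a q

  deriv-summand : ∀ {a p p₁} → p —⟨ a ⟩→ p₁ → p₁ ⊆→ deriv a p
  deriv-summand {a} act t with a ≟ a
  ... | yes _  = t
  ... | no a≢a = ⊥-elim (a≢a ≡.refl)
  deriv-summand (sumˡ u) t = sumˡ (deriv-summand u t)
  deriv-summand (sumʳ u) t = sumʳ (deriv-summand u t)

  deriv-step⁻¹ : ∀ {a b s} p → deriv a p —⟨ b ⟩→ s → ∃ λ p₁ → (p —⟨ a ⟩→ p₁) × (p₁ —⟨ b ⟩→ s)
  deriv-step⁻¹ 𝟎 ()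
  deriv-step⁻¹ (var ())
  deriv-step⁻¹ {a} (c · p) t with a ≟ c
  deriv-step⁻¹ (c · p) t  | yes ≡.refl = p , act , t
  deriv-step⁻¹ (c · p) () | no _
  deriv-step⁻¹ (p ⊕ q) (sumˡ t) with deriv-step⁻¹ p t
  ... | p₁ , u , t' = p₁ , sumˡ u , t'
  deriv-step⁻¹ (p ⊕ q) (sumʳ t) with deriv-step⁻¹ q t
  ... | p₁ , u , t' = p₁ , sumʳ u , t'

  deriv-trace : ∀ {a p} w → Trace p (a ∷ w) → Trace (deriv a p) w
  deriv-trace []      _              = _ , done
  deriv-trace (_ ∷ _) (s , step t r) = s , ⊆→-path (deriv-summand t) r

  deriv-trace⁻¹ : ∀ {a p w} → Enabled a p → Trace (deriv a p) w → Trace p (a ∷ w)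
  deriv-trace⁻¹ (p₁ , t) (_ , done)     = p₁ , step t done
  deriv-trace⁻¹ {p = p} _ (s , step t r) with deriv-step⁻¹ p t
  ... | _ , u , t' = s , step u (step t' r)

  enabled? : ∀ a p → Dec (Enabled a p)
  enabled? a 𝟎 = no λ ()
  enabled? a (var ())
  enabled? a (b · p) with a ≟ b
  ... | yes ≡.refl = yes (p , act)
  ... | no a≢b     = no λ { (_ , act) → a≢b ≡.refl }
  enabled? a (p ⊕ q) = map′ join split (enabled? a p ⊎-dec enabled? a q)
    where
      join : Enabled a p ⊎ Enabled a q → Enabled a (p ⊕ q)
      join (inj₁ (s , t)) = s , sumˡ t
      join (inj₂ (s , t)) = s , sumʳ t
      split : Enabled a (p ⊕ q) → Enabled a p ⊎ Enabled a q
      split (s , sumˡ t) = inj₁ (s , t)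
      split (s , sumʳ t) = inj₂ (s , t)

  -- a·w is a trace of p iff a is enabled and w is a trace of deriv a p
  trace? : ∀ p w → Dec (Trace p w)
  trace? p []      = yes (p , done)
  trace? p (a ∷ w) =
    map′ (λ (en , tr) → deriv-trace⁻¹ en tr) (λ tr → enabled-of tr , deriv-trace w tr)
         (enabled? a p ×-dec trace? (deriv a p) w)

module Characterisation (A : Set) (_≟_ : DecidableEquality A) where

  open Traces A
  open Derivatives A _≟_

  infix 4 _≾ᶠ_

  _≾ᶠ_ : Closed A → Closed A → Set
  p ≾ᶠ q = ∀ {a w p'} → p —⟨ a ∷ w ⟩→* p' → ∃ λ q' → (q —⟨ a ∷ w ⟩→* q') × q' ⊆T p'

  ≾ᶠ-⊕ˡ : ∀ {p₁ p₂ q} → p₁ ⊕ p₂ ≾ᶠ q → p₁ ≾ᶠ q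
  ≾ᶠ-⊕ˡ m run = m (⊆→-path sumˡ run)

  ≾ᶠ-⊕ʳ : ∀ {p₁ p₂ q} → p₁ ⊕ p₂ ≾ᶠ q → p₂ ≾ᶠ q
  ≾ᶠ-⊕ʳ m run = m (⊆→-path sumʳ run)

  -- the two conditions suffice: an impossible future of p along w is one of q
  -- via q itself (w empty) or via the matching run (w nonempty)
  ≾IF-intro : ∀ {p q} → q ⊆T p → p ≾ᶠ q → p ≾IF q
  ≾IF-intro {q = q} q⊆p m [] B (_ , done , avoids) = q , done , λ v tr → avoids v (q⊆p tr)
  ≾IF-intro q⊆p m (a ∷ w) B (_ , run , avoids) with m run
  ... | q' , run' , q'⊆p' = q' , run' , λ v tr → avoids v (q'⊆p' tr)

  -- the impossible future (w, complement of the traces of p') of p yields a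
  -- matching run of q; decidability of traces removes the double negation
  ≾IF⇒matched : ∀ {p q w p'} → p ≾IF q → p —⟨ w ⟩→* p' →
                ∃ λ q' → (q —⟨ w ⟩→* q') × q' ⊆T p'
  ≾IF⇒matched {w = w} {p'} p≾q run with p≾q w (¬_ ∘ Trace p') (p' , run , λ _ tr ¬tr → ¬tr tr)
  ... | q' , run' , disjoint = q' , run' , λ {v} tr → decidable-stable (trace? p' v) (disjoint v tr)

  ≾IF⇒⊇T : ∀ {p q} → p ≾IF q → q ⊆T p
  ≾IF⇒⊇T p≾q with ≾IF⇒matched p≾q done
  ... | _ , done , q⊆p = q⊆p

  ≾IF⇒≾ᶠ : ∀ {p q} → p ≾IF q → p ≾ᶠ q
  ≾IF⇒≾ᶠ p≾q = ≾IF⇒matched p≾q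

module Soundness (A : Set) (_≟_ : DecidableEquality A) where

  open AxiomaticLaws A using (_⊑_)
  open Traces A
  open Characterisation A _≟_

  ≾IF-by-steps : ∀ {p q} → q ⊆T p → p ⊆→ q → p ≾IF q
  ≾IF-by-steps q⊆p p→q = ≾IF-intro q⊆p (λ run → _ , ⊆→-path p→q run , id)

  ≾IF-same-steps : ∀ {p q} → p ⊆→ q → q ⊆→ p → p ≾IF q
  ≾IF-same-steps p→q q→p = ≾IF-by-steps (steps⇒traces q→p) p→q

  ⊕-comm-steps : ∀ {p q : Closed A} → p ⊕ q ⊆→ q ⊕ p
  ⊕-comm-steps (sumˡ t) = sumʳ t
  ⊕-comm-steps (sumʳ t) = sumˡ t

  ⊕-assoc-steps : ∀ {p q r : Closed A} → (p ⊕ q) ⊕ r ⊆→ p ⊕ (q ⊕ r)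
  ⊕-assoc-steps (sumˡ (sumˡ t)) = sumˡ t
  ⊕-assoc-steps (sumˡ (sumʳ t)) = sumʳ (sumˡ t)
  ⊕-assoc-steps (sumʳ t)        = sumʳ (sumʳ t)

  ⊕-assoc-steps⁻¹ : ∀ {p q r : Closed A} → p ⊕ (q ⊕ r) ⊆→ (p ⊕ q) ⊕ r
  ⊕-assoc-steps⁻¹ (sumˡ t)        = sumˡ (sumˡ t)
  ⊕-assoc-steps⁻¹ (sumʳ (sumˡ t)) = sumˡ (sumʳ t)
  ⊕-assoc-steps⁻¹ (sumʳ (sumʳ t)) = sumʳ t

  ⊕-idem-steps : ∀ {p : Closed A} → p ⊕ p ⊆→ p
  ⊕-idem-steps (sumˡ t) = t
  ⊕-idem-steps (sumʳ t) = t

  ⊕-identity-steps : ∀ {p : Closed A} → p ⊕ 𝟎 ⊆→ p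
  ⊕-identity-steps (sumˡ t) = t

  sound-IF1 : ∀ a (p q : Closed A) → (a · (p ⊕ q)) ≾IF (a · p ⊕ a · q)
  sound-IF1 a p q = ≾IF-intro traces futures
    where
      traces : a · p ⊕ a · q ⊆T a · (p ⊕ q)
      traces (_ , done)               = _ , done
      traces (s , step (sumˡ act) r) = trace-· (trace-⊕ˡ (s , r))
      traces (s , step (sumʳ act) r) = trace-· (trace-⊕ʳ (s , r))
      futures : a · (p ⊕ q) ≾ᶠ a · p ⊕ a · q
      futures (step act done)              = p , step (sumˡ act) done , trace-⊕ˡ
      futures (step act (step (sumˡ t) r)) = _ , step (sumˡ act) (step t r) , id
      futures (step act (step (sumʳ t) r)) = _ , step (sumʳ act) (step t r) , id

  IF2-steps : ∀ a (p q r : Closed A) → a · p ⊕ a · (q ⊕ r) ⊆→ a · (p ⊕ q) ⊕ a · p ⊕ a · (q ⊕ r)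
  IF2-steps a p q r (sumˡ t) = sumˡ (sumʳ t)
  IF2-steps a p q r (sumʳ t) = sumʳ t

  sound-IF2 : ∀ a (p q r : Closed A) → (a · p ⊕ a · (q ⊕ r)) ≾IF (a · (p ⊕ q) ⊕ a · p ⊕ a · (q ⊕ r))
  sound-IF2 a p q r = ≾IF-by-steps traces (IF2-steps a p q r)
    where
      traces : a · (p ⊕ q) ⊕ a · p ⊕ a · (q ⊕ r) ⊆T a · p ⊕ a · (q ⊕ r)
      traces (_ , done) = _ , done
      traces (s , step (sumˡ (sumˡ act)) rest) with trace-⊕⁻¹ (s , rest)
      ... | inj₁ tr = trace-⊕ˡ (trace-· tr)
      ... | inj₂ tr = trace-⊕ʳ (trace-· (trace-⊕ˡ tr))
      traces (s , step (sumˡ (sumʳ t)) rest) = s , step (sumˡ t) rest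
      traces (s , step (sumʳ t) rest)        = s , step (sumʳ t) rest

  sound-IF2⁻¹ : ∀ a (p q r : Closed A) → (a · (p ⊕ q) ⊕ a · p ⊕ a · (q ⊕ r)) ≾IF (a · p ⊕ a · (q ⊕ r))
  sound-IF2⁻¹ a p q r = ≾IF-intro (steps⇒traces (IF2-steps a p q r)) futures
    where
      futures : a · (p ⊕ q) ⊕ a · p ⊕ a · (q ⊕ r) ≾ᶠ a · p ⊕ a · (q ⊕ r)
      futures (step (sumˡ (sumˡ act)) done)              = p , step (sumˡ act) done , trace-⊕ˡ
      futures (step (sumˡ (sumˡ act)) (step (sumˡ t) r)) = _ , step (sumˡ act) (step t r) , id
      futures (step (sumˡ (sumˡ act)) (step (sumʳ t) r)) = _ , step (sumʳ act) (step (sumˡ t) r) , id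
      futures (step (sumˡ (sumʳ t)) r)                   = _ , step (sumˡ t) r , id
      futures (step (sumʳ t) r)                          = _ , step (sumʳ t) r , id

  sound-axiom : ∀ {t u : Open A} → Axiom t u → t ≾IFᵒ u
  sound-axiom A1       σ = ≾IF-same-steps ⊕-comm-steps ⊕-comm-steps
  sound-axiom A1'      σ = ≾IF-same-steps ⊕-comm-steps ⊕-comm-steps
  sound-axiom A2       σ = ≾IF-same-steps ⊕-assoc-steps ⊕-assoc-steps⁻¹
  sound-axiom A2'      σ = ≾IF-same-steps ⊕-assoc-steps⁻¹ ⊕-assoc-steps
  sound-axiom A3       σ = ≾IF-same-steps ⊕-idem-steps sumˡ
  sound-axiom A3'      σ = ≾IF-same-steps sumˡ ⊕-idem-steps
  sound-axiom A4       σ = ≾IF-same-steps ⊕-identity-steps sumˡ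
  sound-axiom A4'      σ = ≾IF-same-steps sumˡ ⊕-identity-steps
  sound-axiom (IF1 a)  σ = sound-IF1 a (σ 0) (σ 1)
  sound-axiom (IF2 a)  σ = sound-IF2 a (σ 0) (σ 1) (σ 2)
  sound-axiom (IF2' a) σ = sound-IF2⁻¹ a (σ 0) (σ 1) (σ 2)

  ≾IF-cong-· : ∀ {p q} a → p ≾IF q → (a · p) ≾IF (a · q)
  ≾IF-cong-· {p} {q} a p≾q = ≾IF-intro traces futures
    where
      traces : a · q ⊆T a · p
      traces (_ , done)       = _ , done
      traces (s , step act r) = trace-· (≾IF⇒⊇T p≾q (s , r))
      futures : a · p ≾ᶠ a · q
      futures (step act run) with ≾IF⇒matched p≾q run
      ... | q' , run' , q'⊆p' = q' , step act run' , q'⊆p'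

  ≾IF-cong-⊕ : ∀ {p p' q q'} → p ≾IF p' → q ≾IF q' → (p ⊕ q) ≾IF (p' ⊕ q')
  ≾IF-cong-⊕ {p} {p'} {q} {q'} p≾p' q≾q' = ≾IF-intro traces futures
    where
      traces : p' ⊕ q' ⊆T p ⊕ q
      traces tr with trace-⊕⁻¹ tr
      ... | inj₁ tr' = trace-⊕ˡ (≾IF⇒⊇T p≾p' tr')
      ... | inj₂ tr' = trace-⊕ʳ (≾IF⇒⊇T q≾q' tr')
      futures : p ⊕ q ≾ᶠ p' ⊕ q'
      futures (step (sumˡ t) r) with ≾IF⇒≾ᶠ p≾p' (step t r)
      ... | s , run , s⊆ = s , ⊆→-path sumˡ run , s⊆
      futures (step (sumʳ t) r) with ≾IF⇒≾ᶠ q≾q' (step t r)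
      ... | s , run , s⊆ = s , ⊆→-path sumʳ run , s⊆

  subst-subst : ∀ {U V W} (τ : V → Term A W) (σ : U → Term A V) t →
                subst τ (subst σ t) ≡ subst (subst τ ∘ σ) t
  subst-subst τ σ 𝟎       = ≡.refl
  subst-subst τ σ (var _) = ≡.refl
  subst-subst τ σ (a · t) = ≡.cong (a ·_) (subst-subst τ σ t)
  subst-subst τ σ (t ⊕ u) = ≡.cong₂ _⊕_ (subst-subst τ σ t) (subst-subst τ σ u)

  sound : ∀ {t u : Open A} → t ⊑ u → t ≾IFᵒ u
  sound (ax α)      σ = sound-axiom α σ
  sound refl        σ = λ _ _ fut → fut
  sound (trans d e) σ = λ w B → sound e σ w B ∘ sound d σ w B
  sound (inst {t} {u} ρ d) σ
    rewrite subst-subst σ ρ t | subst-subst σ ρ u = sound d (subst σ ∘ ρ)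
  sound (ctx· a d)  σ = ≾IF-cong-· a (sound d σ)
  sound (ctx⊕ d e)  σ = ≾IF-cong-⊕ (sound d σ) (sound e σ)

module Completeness (A : Set) (_≟_ : DecidableEquality A) where

  open AxiomaticLaws A
  open Traces A
  open Derivatives A _≟_
  open Characterisation A _≟_
  open ⊑-Reasoning

  ⌜_⌝ : Closed A → Open A
  ⌜_⌝ = embed

  summand-absorbed : ∀ {p a p'} → p —⟨ a ⟩→ p' → ⌜ p ⌝ absorbs a · ⌜ p' ⌝
  summand-absorbed act             = absorbs-self _
  summand-absorbed (sumˡ {u = u} t) = absorbs-⊕ˡ ⌜ u ⌝ (summand-absorbed t)
  summand-absorbed (sumʳ {u = u} t) = absorbs-⊕ʳ ⌜ u ⌝ (summand-absorbed t)

  deriv-null : ∀ {a} p → ¬ Enabled a p → ⌜ deriv a p ⌝ ≈ 𝟎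
  deriv-null 𝟎 _ = refl , refl
  deriv-null (var ())
  deriv-null {a} (b · p) ¬en with a ≟ b
  ... | yes ≡.refl = ⊥-elim (¬en (p , act))
  ... | no _       = refl , refl
  deriv-null (p ⊕ q) ¬en with deriv-null p (¬en ∘ λ (s , t) → s , sumˡ t)
                            | deriv-null q (¬en ∘ λ (s , t) → s , sumʳ t)
  ... | p≈𝟎 | q≈𝟎 = trans (ctx⊕ (proj₁ p≈𝟎) (proj₁ q≈𝟎)) (proj₁ (⊕-identity 𝟎))
                  , trans (proj₂ (⊕-identity 𝟎)) (ctx⊕ (proj₂ p≈𝟎) (proj₂ q≈𝟎))

  -- if a is enabled, p absorbs a·(sum of its a-derivatives); this is where IF2 merges
  -- a-summands coming from different sides of a sum
  deriv-absorbed : ∀ {a} p → Enabled a p → ⌜ p ⌝ absorbs a · ⌜ deriv a p ⌝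
  deriv-absorbed 𝟎 (_ , ())
  deriv-absorbed (var ())
  deriv-absorbed {a} (b · p) (_ , act) with a ≟ a
  ... | yes _  = absorbs-self _
  ... | no a≢a = ⊥-elim (a≢a ≡.refl)
  deriv-absorbed {a} (p ⊕ q) en with enabled? a p | enabled? a q
  ... | yes enp | yes enq =
    absorbs-trans (absorbs-⊕ (absorbs-⊕ˡ ⌜ q ⌝ (deriv-absorbed p enp))
                             (absorbs-⊕ʳ ⌜ p ⌝ (deriv-absorbed q enq)))
                  (·-absorbs a _ _)
  ... | yes enp | no ¬enq =
    absorbs-resp (absorbs-⊕ˡ ⌜ q ⌝ (deriv-absorbed p enp))
                 (·-cong a (⊕-nullʳ _ (deriv-null q ¬enq)))
  ... | no ¬enp | yes enq =
    absorbs-resp (absorbs-⊕ʳ ⌜ p ⌝ (deriv-absorbed q enq))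
                 (·-cong a (⊕-nullˡ _ (deriv-null p ¬enp)))
  ... | no ¬enp | no ¬enq with en
  ...   | s , sumˡ t = ⊥-elim (¬enp (s , t))
  ...   | s , sumʳ t = ⊥-elim (¬enq (s , t))

  pump : ∀ q {p} → q ⊆T p → ⌜ p ⌝ ⊑ ⌜ p ⌝ ⊕ ⌜ q ⌝
  pump 𝟎 _ = proj₂ (⊕-identity _)
  pump (var ())
  pump (q₁ ⊕ q₂) {p} q⊆p = begin
    ⌜ p ⌝                       ≲⟨ pump q₁ (λ tr → q⊆p (trace-⊕ˡ tr)) ⟩
    ⌜ p ⌝ ⊕ ⌜ q₁ ⌝               ≲⟨ pump q₂ {p ⊕ q₁} (λ tr → trace-⊕ˡ (q⊆p (trace-⊕ʳ tr))) ⟩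
    (⌜ p ⌝ ⊕ ⌜ q₁ ⌝) ⊕ ⌜ q₂ ⌝     ≲⟨ ⊕-assocˡ _ _ _ ⟩
    ⌜ p ⌝ ⊕ (⌜ q₁ ⌝ ⊕ ⌜ q₂ ⌝)     ∎
  pump (b · q) {p} q⊆p = begin
    ⌜ p ⌝                               ≲⟨ proj₂ absorbed ⟩
    ⌜ p ⌝ ⊕ b · ⌜ d ⌝                    ≲⟨ ⊕-congʳ (ctx· b (pump q q⊆d)) ⟩
    ⌜ p ⌝ ⊕ b · (⌜ d ⌝ ⊕ ⌜ q ⌝)           ≲⟨ ⊕-congʳ (·-split b _ _) ⟩
    ⌜ p ⌝ ⊕ (b · ⌜ d ⌝ ⊕ b · ⌜ q ⌝)       ≲⟨ ⊕-assocʳ _ _ _ ⟩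
    (⌜ p ⌝ ⊕ b · ⌜ d ⌝) ⊕ b · ⌜ q ⌝       ≲⟨ ⊕-congˡ (proj₁ absorbed) ⟩
    ⌜ p ⌝ ⊕ b · ⌜ q ⌝                    ∎
    where
      d : Closed A
      d = deriv b p
      q⊆d : q ⊆T d
      q⊆d {v} tr = deriv-trace v (q⊆p (trace-· tr))
      absorbed : ⌜ p ⌝ absorbs b · ⌜ d ⌝
      absorbed = deriv-absorbed p (enabled-of (q⊆p (trace-· (q , done))))

  absorb-future : ∀ {q a} r → a · r ≾ᶠ q → ⌜ q ⌝ ⊕ a · ⌜ r ⌝ ⊑ ⌜ q ⌝
  absorb-under  : ∀ {t a d} r → t absorbs a · ⌜ d ⌝ → r ≾ᶠ d → t ⊕ a · (⌜ r ⌝ ⊕ ⌜ d ⌝) ⊑ t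

  -- a summand a·r whose futures are matched in q is absorbed by q: the first step
  -- of the match gives q —a→ q₀ with traces(q₀) ⊆ traces(r), so a·r ≼ a·(q₀ + r),
  -- which IF2 absorbs into a·q₀ + a·(r + deriv a q)
  absorb-future {q} {a} r ar≾q with ar≾q (step act done)
  ... | q₀ , step q→q₀ done , q₀⊆r = begin
    ⌜ q ⌝ ⊕ a · ⌜ r ⌝                                      ≲⟨ ⊕-congʳ (ctx· a (trans (pump q₀ q₀⊆r) (⊕-comm _ _))) ⟩
    ⌜ q ⌝ ⊕ a · (⌜ q₀ ⌝ ⊕ ⌜ r ⌝)                            ≲⟨ ⊕-congˡ (proj₂ absorbed) ⟩
    (⌜ q ⌝ ⊕ (a · ⌜ q₀ ⌝ ⊕ a · R)) ⊕ a · (⌜ q₀ ⌝ ⊕ ⌜ r ⌝)     ≲⟨ ⊕-assocˡ _ _ _ ⟩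
    ⌜ q ⌝ ⊕ ((a · ⌜ q₀ ⌝ ⊕ a · R) ⊕ a · (⌜ q₀ ⌝ ⊕ ⌜ r ⌝))     ≲⟨ ⊕-congʳ (⊕-comm _ _) ⟩
    ⌜ q ⌝ ⊕ (a · (⌜ q₀ ⌝ ⊕ ⌜ r ⌝) ⊕ (a · ⌜ q₀ ⌝ ⊕ a · R))     ≲⟨ ⊕-congʳ (⊕-assocʳ _ _ _) ⟩
    ⌜ q ⌝ ⊕ (a · (⌜ q₀ ⌝ ⊕ ⌜ r ⌝) ⊕ a · ⌜ q₀ ⌝ ⊕ a · R)       ≲⟨ ⊕-congʳ (proj₂ (·-saturate a _ _ _)) ⟩
    ⌜ q ⌝ ⊕ (a · ⌜ q₀ ⌝ ⊕ a · R)                            ≲⟨ proj₁ absorbed ⟩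
    ⌜ q ⌝                                                  ∎
    where
      d : Closed A
      d = deriv a q
      R : Open A
      R = ⌜ r ⌝ ⊕ ⌜ d ⌝
      r≾d : r ≾ᶠ d
      r≾d run with ar≾q (step act run)
      ... | q' , step t run' , q'⊆ = q' , ⊆→-path (deriv-summand t) run' , q'⊆
      ar+d⊆q : a · (r ⊕ d) ⊆T q
      ar+d⊆q (_ , done) = _ , done
      ar+d⊆q (s , step act run) with trace-⊕⁻¹ (s , run)
      ... | inj₁ (_ , run') with ar≾q (step act run')
      ...   | q' , run'' , _ = q' , run''
      ar+d⊆q (s , step act run) | inj₂ tr = deriv-trace⁻¹ (q₀ , q→q₀) tr
      absorbed : ⌜ q ⌝ absorbs (a · ⌜ q₀ ⌝ ⊕ a · R)
      absorbed = absorbs-⊕ (summand-absorbed q→q₀)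
                           (absorb-under r (deriv-absorbed q (q₀ , q→q₀)) r≾d , pump (a · (r ⊕ d)) ar+d⊆q)

  -- a·(r + d) is absorbed wherever a·d is, provided the futures of r are matched in d;
  -- IF1 splits sums in r, and a summand b·r' of r is absorbed into d itself
  absorb-under 𝟎 t≈ _ = trans (⊕-congʳ (ctx· _ (trans (⊕-comm 𝟎 _) (proj₁ (⊕-identity _))))) (proj₁ t≈)
  absorb-under (var ())
  absorb-under {t} {a} {d} (r₁ ⊕ r₂) t≈ r≾d = begin
    t ⊕ a · ((⌜ r₁ ⌝ ⊕ ⌜ r₂ ⌝) ⊕ ⌜ d ⌝)                     ≲⟨ ⊕-congʳ (ctx· a (⊕-distrib _ _ _)) ⟩
    t ⊕ a · ((⌜ r₁ ⌝ ⊕ ⌜ d ⌝) ⊕ (⌜ r₂ ⌝ ⊕ ⌜ d ⌝))            ≲⟨ ⊕-congʳ (·-split a _ _) ⟩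
    t ⊕ (a · (⌜ r₁ ⌝ ⊕ ⌜ d ⌝) ⊕ a · (⌜ r₂ ⌝ ⊕ ⌜ d ⌝))        ≲⟨ ⊕-assocʳ _ _ _ ⟩
    (t ⊕ a · (⌜ r₁ ⌝ ⊕ ⌜ d ⌝)) ⊕ a · (⌜ r₂ ⌝ ⊕ ⌜ d ⌝)        ≲⟨ ⊕-congˡ (absorb-under r₁ t≈ (≾ᶠ-⊕ˡ r≾d)) ⟩
    t ⊕ a · (⌜ r₂ ⌝ ⊕ ⌜ d ⌝)                              ≲⟨ absorb-under r₂ t≈ (≾ᶠ-⊕ʳ r≾d) ⟩
    t                                                   ∎
  absorb-under {t} {a} {d} (b · r) t≈ br≾d = begin
    t ⊕ a · (b · ⌜ r ⌝ ⊕ ⌜ d ⌝)     ≲⟨ ⊕-congʳ (ctx· a (⊕-comm _ _)) ⟩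
    t ⊕ a · (⌜ d ⌝ ⊕ b · ⌜ r ⌝)     ≲⟨ ⊕-congʳ (ctx· a (absorb-future r br≾d)) ⟩
    t ⊕ a · ⌜ d ⌝                  ≲⟨ proj₁ t≈ ⟩
    t                            ∎

  absorb-matched : ∀ p {q} → p ≾ᶠ q → ⌜ q ⌝ ⊕ ⌜ p ⌝ ⊑ ⌜ q ⌝
  absorb-matched 𝟎 _ = proj₁ (⊕-identity _)
  absorb-matched (var ())
  absorb-matched (p₁ ⊕ p₂) p≾q =
    trans (⊕-assocʳ _ _ _)
          (trans (⊕-congˡ (absorb-matched p₁ (≾ᶠ-⊕ˡ p≾q))) (absorb-matched p₂ (≾ᶠ-⊕ʳ p≾q)))
  absorb-matched (a · r) p≾q = absorb-future r p≾q

  complete : ∀ p q → p ≾IF q → Axiom ⊢ embed p ≼ embed q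
  complete p q p≾q = begin
    ⌜ p ⌝            ≲⟨ pump q (≾IF⇒⊇T p≾q) ⟩
    ⌜ p ⌝ ⊕ ⌜ q ⌝     ≲⟨ ⊕-comm _ _ ⟩
    ⌜ q ⌝ ⊕ ⌜ p ⌝     ≲⟨ absorb-matched p (≾IF⇒≾ᶠ p≾q) ⟩
    ⌜ q ⌝            ∎

-- Equality of actions is decidable through the injection into ℕ.
theorem5p1 : (A : Set) → A → (A ↣ ℕ) →
    ((t u : Open A) → Axiom ⊢ t ≼ u → t ≾IFᵒ u)
    × ((p q : Closed A) → p ≾IF q → Axiom ⊢ embed p ≼ embed q)
theorem5p1 A _ A↣ℕ = (λ _ _ → sound) , complete
  where
    _≟_ : DecidableEquality A
    _≟_ = via-injection A↣ℕ ℕ._≟_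
    open Soundness A _≟_ using (sound)
    open Completeness A _≟_ using (complete)
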